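{- Let $\Delta$ be a matroid on the ground set $[n]$ such that $[d]$ is a basis of $\Delta$, with its bases ordered lexicographically with respect to the natural order of $[n]$. Let $I$ be an independent set of $\Delta$ with $I\cap[d]=\emptyset$, and let $$U_I:=\{\mathcal{R}(B,\Delta)-I \;:\; B \text{ a basis of }\Delta,\ B-[d]=I\}.$$ Let $G_1,\dots,G_\ell$ be the bases of $\Gamma_I$, ordered lexicographically with respect to the natural order on $[d]$, and let $V_I=\{\mathcal{R}(G_i,\Gamma_I)\,:\,1\le i\le \ell\}$. Then $U_I=V_I$.
   Context: $\Gamma_I$ is the matroid on $[d]$ whose independent sets are the subsets $G\subseteq[d]$ such that $G\cup I$ is independent in $\Delta$. For a matroid $M$ with a shelling order $B_1,\dots,B_k$ of its bases (here always the lexicographic order), $\mathcal{R}(B_i,M)$ denotes the restriction set: the unique subset of $B_i$ such that $A\subseteq B_i$ is not contained in any $B_j$, $j<i$, if and only if $\mathcal{R}(B_i,M)\subseteq A$. -}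

module Defs where

open import Data.Nat using (ℕ; _≤_; _<_; _<?_)
open import Data.Fin using (Fin; toℕ; fromℕ<)
open import Data.Fin.Subset using (Subset; ⊥; ⁅_⁆; _∈_; _∉_; _⊆_; _∩_; _∪_; _─_; ∣_∣)
open import Data.Bool using (Bool; T; false)
open import Data.Vec using (tabulate; lookup)
open import Data.Product using (Σ; ∃; _×_; ∃-syntax)
open import Relation.Nullary using (¬_; yes; no; ⌊_⌋)
open import Relation.Binary.PropositionalEquality using (_≡_)

Family : ℕ → Set
Family n = Subset n → Bool

Indep : ∀ {n} → Family n → Subset n → Set
Indep F X = T (F X)

record IsMatroid {n : ℕ} (F : Family n) : Set where
  field
    empty-indep : Indep F ⊥
    hereditary  : ∀ X Y → X ⊆ Y → Indep F Y → Indep F X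
    exchange    : ∀ X Y → Indep F X → Indep F Y → ∣ X ∣ < ∣ Y ∣ →
                  ∃[ y ] (y ∈ Y × y ∉ X × Indep F (X ∪ ⁅ y ⁆))

IsBasis : ∀ {n} → Family n → Subset n → Set
IsBasis F B = Indep F B × (∀ A → Indep F A → B ⊆ A → A ≡ B)

-- Lexicographic order on subsets of Fin n w.r.t. the natural order:
-- A comes before B iff the smallest element of the symmetric difference lies in A.
-- (For sets of equal size, as bases are, this is the lexicographic order of their
-- increasingly sorted element lists.)
_<lex_ : ∀ {n} → Subset n → Subset n → Set
_<lex_ {n} A B = ∃[ i ] (i ∈ A × i ∉ B ×
                   (∀ (j : Fin n) → toℕ j < toℕ i → (j ∈ A → j ∈ B) × (j ∈ B → j ∈ A)))

-- R is the restriction set R(B, M) of the basis B of M w.r.t. the lexicographic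
-- shelling order of the bases of M: R ⊆ B and, for every A ⊆ B, A is contained in
-- no earlier basis iff R ⊆ A.
InEarlier : ∀ {n} → Family n → Subset n → Subset n → Set
InEarlier F B A = ∃[ B' ] (IsBasis F B' × B' <lex B × A ⊆ B')

IsRestriction : ∀ {n} → Family n → Subset n → Subset n → Set
IsRestriction F B R =
  IsBasis F B × R ⊆ B ×
  (∀ A → A ⊆ B →
     ((¬ InEarlier F B A) → R ⊆ A) ×
     (R ⊆ A → ¬ InEarlier F B A))

firstD : ∀ {n} (d : ℕ) → Subset n
firstD d = tabulate (λ i → ⌊ toℕ i <? d ⌋)

liftSub : ∀ {d n} → d ≤ n → Subset d → Subset n
liftSub {d} p G = tabulate (λ i → helper i)
  where
  helper : _ → Bool
  helper i with toℕ i <? d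
  ... | yes q = lookup G (fromℕ< q)
  ... | no _  = false

Gamma : ∀ {d n} → d ≤ n → Family n → Subset n → Family d
Gamma p F I G = F (liftSub p G ∪ I)

InU : ∀ {n} (d : ℕ) → Family n → Subset n → Subset n → Set
InU d F I X = ∃[ B ] ∃[ R ] (IsBasis F B × (B ─ firstD d) ≡ I ×
                              IsRestriction F B R × X ≡ (R ─ I))

InV : ∀ {d n} → d ≤ n → Family n → Subset n → Subset d → Set
InV p F I S = ∃[ G ] (IsBasis (Gamma p F I) G × IsRestriction (Gamma p F I) G S)

module Submission where

-- Sending a basis G of Γ_I to G ∪ I (G ⊆ [d] read inside [n]) is a bijection onto the bases B of Δ
-- with B − [d] = I, and it preserves the lexicographic order. For A ⊆ G, A lies in an earlier basis
-- of Γ_I iff A ∪ I lies in an earlier basis of Δ, so restriction sets correspond: R(G ∪ I, Δ) − I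
-- is R(G, Γ_I). Restriction sets are unique when they exist, and in a matroid R(B) always exists:
-- it consists of the b ∈ B that can be exchanged for a smaller element outside B.

open import Defs
open import Data.Nat using (ℕ; zero; suc; z≤n; s≤s; _≤_; _<_; _≤?_; _<?_; _+_)
open import Data.Nat.Properties
  using ( ≤-trans; ≤-reflexive; ≤-antisym; +-comm; +-suc; +-monoʳ-≤; m≤m+n; n≤1+n
        ; <-irrefl; <-trans; <-≤-trans; ≮⇒≥; ≰⇒>; <-cmp)
open import Data.Fin using (Fin; toℕ; fromℕ<; inject≤; _≟_) renaming (zero to fzero; suc to fsuc)
open import Data.Fin.Properties
  using (toℕ-injective; toℕ-fromℕ<; toℕ-inject≤; toℕ<n; inject≤-injective; any?)
open import Data.Fin.Subset
open import Data.Fin.Subset.Properties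
open import Data.Bool using (Bool; true; false)
open import Data.Bool.Properties using (T-≡)
open import Data.Vec using (tabulate; lookup; []; _∷_; here; there)
open import Data.Vec.Properties using ([]=⇒lookup; lookup⇒[]=; lookup∘tabulate)
open import Data.Product using (_×_; ∃-syntax; _,_; proj₁; proj₂)
open import Data.Sum using (inj₁; inj₂)
open import Data.Empty using (⊥-elim)
open import Function using (_∘_; _∘₂_; _∋_; Equivalence)
open import Relation.Binary using (tri<; tri≈; tri>)
open import Relation.Nullary using (¬_; Dec; yes; no; ⌊_⌋; ¬?; _×-dec_)
open import Relation.Nullary.Decidable using (toWitness; fromWitness; decidable-stable; T?)
open import Relation.Binary.PropositionalEquality
  using (_≡_; _≢_; refl; sym; trans; cong; subst; subst₂)

x∈p─q⁻ : ∀ {n} (p q : Subset n) {x} → x ∈ p ─ q → x ∈ p × x ∉ q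
x∈p─q⁻ (s ∷ p) (inside  ∷ q) {fzero} ()
x∈p─q⁻ (s ∷ p) (outside ∷ q) {fzero} here = here , λ ()
x∈p─q⁻ (s ∷ p) (t ∷ q) {fsuc x} (there x∈) with x∈p─q⁻ p q x∈
... | x∈p , x∉q = there x∈p , x∉q ∘ drop-there

∣p∪q∣≤∣p∣+∣q∣ : ∀ {n} (p q : Subset n) → ∣ p ∪ q ∣ ≤ ∣ p ∣ + ∣ q ∣
∣p∪q∣≤∣p∣+∣q∣ []            []            = z≤n
∣p∪q∣≤∣p∣+∣q∣ (outside ∷ p) (outside ∷ q) = ∣p∪q∣≤∣p∣+∣q∣ p q
∣p∪q∣≤∣p∣+∣q∣ (outside ∷ p) (inside  ∷ q) =
  subst (suc ∣ p ∪ q ∣ ≤_) (sym (+-suc ∣ p ∣ ∣ q ∣)) (s≤s (∣p∪q∣≤∣p∣+∣q∣ p q))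
∣p∪q∣≤∣p∣+∣q∣ (inside  ∷ p) (outside ∷ q) = s≤s (∣p∪q∣≤∣p∣+∣q∣ p q)
∣p∪q∣≤∣p∣+∣q∣ (inside  ∷ p) (inside  ∷ q) =
  s≤s (≤-trans (∣p∪q∣≤∣p∣+∣q∣ p q) (+-monoʳ-≤ ∣ p ∣ (n≤1+n ∣ q ∣)))

module _ {n : ℕ} where

  ∈tabulate⁻ : ∀ (f : Fin n → Bool) {x} → x ∈ tabulate f → f x ≡ true
  ∈tabulate⁻ f {x} x∈ = trans (sym (lookup∘tabulate f x)) ([]=⇒lookup x∈)

  ∈tabulate⁺ : ∀ (f : Fin n → Bool) {x} → f x ≡ true → x ∈ tabulate f
  ∈tabulate⁺ f {x} fx = lookup⇒[]= x _ (trans (lookup∘tabulate f x) fx)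

  module _ {P : Fin n → Set} (P? : ∀ x → Dec (P x)) where

    ∈tabulate-⌊⌋⁻ : ∀ {x} → x ∈ tabulate (λ y → ⌊ P? y ⌋) → P x
    ∈tabulate-⌊⌋⁻ x∈ = toWitness (Equivalence.from T-≡ (∈tabulate⁻ _ x∈))

    ∈tabulate-⌊⌋⁺ : ∀ {x} → P x → x ∈ tabulate (λ y → ⌊ P? y ⌋)
    ∈tabulate-⌊⌋⁺ px = ∈tabulate⁺ _ (Equivalence.to T-≡ (fromWitness px))

  x∈p-y⁻ : ∀ {p : Subset n} {x y} → x ∈ p - y → x ∈ p × x ≢ y
  x∈p-y⁻ {p} {x} {y} x∈ with x∈p─q⁻ p ⁅ y ⁆ x∈
  ... | x∈p , x∉⁅y⁆ = x∈p , x∉⁅y⁆⇒x≢y x∉⁅y⁆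

  ∣p∪⁅x⁆∣≤1+∣p∣ : ∀ (p : Subset n) x → ∣ p ∪ ⁅ x ⁆ ∣ ≤ suc ∣ p ∣
  ∣p∪⁅x⁆∣≤1+∣p∣ p x = ≤-trans (∣p∪q∣≤∣p∣+∣q∣ p ⁅ x ⁆)
    (≤-reflexive (trans (cong (∣ p ∣ +_) (∣⁅x⁆∣≡1 x)) (+-comm ∣ p ∣ 1)))

  p⊆p-x∪⁅x⁆ : ∀ (p : Subset n) x → p ⊆ (p - x) ∪ ⁅ x ⁆
  p⊆p-x∪⁅x⁆ p x {y} y∈p with y ≟ x
  ... | yes refl = x∈p∪q⁺ (inj₂ (x∈⁅x⁆ x))
  ... | no  y≢x  = x∈p∪q⁺ (inj₁ (x∈p∧x≢y⇒x∈p-y y∈p y≢x))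

  ∣p-x∪⁅y⁆∣≡∣p∣ : ∀ {p : Subset n} {x y} → x ∈ p → y ∉ p → ∣ (p - x) ∪ ⁅ y ⁆ ∣ ≡ ∣ p ∣
  ∣p-x∪⁅y⁆∣≡∣p∣ {p} {x} {y} x∈p y∉p = ≤-antisym
    (≤-trans (∣p∪⁅x⁆∣≤1+∣p∣ (p - x) y) (x∈p⇒∣p-x∣<∣p∣ x∈p))
    (≤-trans (p⊆q⇒∣p∣≤∣q∣ (p⊆p-x∪⁅x⁆ p x))
      (≤-trans (∣p∪⁅x⁆∣≤1+∣p∣ (p - x) x)
        (p⊂q⇒∣p∣<∣q∣ (p⊆p∪q ⁅ y ⁆ , y , x∈p∪q⁺ (inj₂ (x∈⁅x⁆ y)) , y∉p ∘ proj₁ ∘ x∈p-y⁻))))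

  p⊆q⇒∣q∣≤∣p∣⇒p≡q : ∀ {p q : Subset n} → p ⊆ q → ∣ q ∣ ≤ ∣ p ∣ → p ≡ q
  p⊆q⇒∣q∣≤∣p∣⇒p≡q {p} {q} p⊆q ∣q∣≤∣p∣ = ⊆-antisym p⊆q q⊆p
    where
    q⊆p : q ⊆ p
    q⊆p {x} x∈q with x ∈? p
    ... | yes x∈p = x∈p
    ... | no  x∉p = ⊥-elim (<-irrefl refl (≤-trans (p⊂q⇒∣p∣<∣q∣ (p⊆q , x , x∈q , x∉p)) ∣q∣≤∣p∣))

swap-<lex : ∀ {n} {B : Subset n} {b e} → toℕ e < toℕ b → b ∈ B → e ∉ B → ((B - b) ∪ ⁅ e ⁆) <lex B
swap-<lex {B = B} {b} {e} e<b b∈B e∉B =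
  e , x∈p∪q⁺ (inj₂ (x∈⁅x⁆ e)) , e∉B , λ j j<e → Swap⊆B j<e , B⊆Swap j<e
  where
  Swap⊆B : ∀ {j} → toℕ j < toℕ e → j ∈ (B - b) ∪ ⁅ e ⁆ → j ∈ B
  Swap⊆B j<e j∈ with x∈p∪q⁻ _ _ j∈
  ... | inj₁ j∈B-b = proj₁ (x∈p-y⁻ j∈B-b)
  ... | inj₂ j∈e   = ⊥-elim (<-irrefl (cong toℕ (x∈⁅y⁆⇒x≡y _ j∈e)) j<e)
  B⊆Swap : ∀ {j} → toℕ j < toℕ e → j ∈ B → j ∈ (B - b) ∪ ⁅ e ⁆
  B⊆Swap j<e j∈B = x∈p∪q⁺ (inj₁ (x∈p∧x≢y⇒x∈p-y j∈B λ { refl → <-irrefl refl (<-trans j<e e<b) }))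

restriction-unique : ∀ {n} {F : Family n} {B R R'} →
                     IsRestriction F B R → IsRestriction F B R' → R ≡ R'
restriction-unique (_ , R⊆B , charR) (_ , R'⊆B , charR') = ⊆-antisym
  (proj₁ (charR _ R'⊆B) (proj₂ (charR' _ R'⊆B) ⊆-refl))
  (proj₁ (charR' _ R⊆B) (proj₂ (charR _ R⊆B) ⊆-refl))

module MatroidProperties {n : ℕ} {F : Family n} (M : IsMatroid F) where
  open IsMatroid M

  indep-size≤basis-size : ∀ {A B} → Indep F A → IsBasis F B → ∣ A ∣ ≤ ∣ B ∣
  indep-size≤basis-size {A} {B} indepA (indepB , maximalB) with ∣ A ∣ ≤? ∣ B ∣
  ... | yes ∣A∣≤∣B∣ = ∣A∣≤∣B∣
  ... | no  ∣A∣≰∣B∣ with exchange B A indepB indepA (≰⇒> ∣A∣≰∣B∣)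
  ... | y , _ , y∉B , indepB∪y =
    ⊥-elim (y∉B (subst (y ∈_) (maximalB _ indepB∪y (p⊆p∪q ⁅ y ⁆)) (x∈p∪q⁺ (inj₂ (x∈⁅x⁆ y)))))

  basis-of-size : ∀ {A B} → Indep F A → IsBasis F B → ∣ B ∣ ≤ ∣ A ∣ → IsBasis F A
  basis-of-size indepA basisB ∣B∣≤∣A∣ = indepA , λ A' indepA' A⊆A' →
    sym (p⊆q⇒∣q∣≤∣p∣⇒p≡q A⊆A' (≤-trans (indep-size≤basis-size indepA' basisB) ∣B∣≤∣A∣))

  -- k bounds the size gap; each step adds one element of Y by the exchange axiom.
  augment : ∀ k {X Y} → Indep F X → Indep F Y → ∣ Y ∣ ≤ k + ∣ X ∣ →
            ∃[ Z ] (Indep F Z × X ⊆ Z × Z ⊆ X ∪ Y × ∣ Y ∣ ≤ ∣ Z ∣)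
  augment zero    {X} {Y} indepX _ ∣Y∣≤∣X∣ = X , indepX , ⊆-refl , p⊆p∪q Y , ∣Y∣≤∣X∣
  augment (suc k) {X} {Y} indepX indepY ∣Y∣≤ with ∣ Y ∣ ≤? ∣ X ∣
  ... | yes ∣Y∣≤∣X∣ = X , indepX , ⊆-refl , p⊆p∪q Y , ∣Y∣≤∣X∣
  ... | no  ∣Y∣≰∣X∣ with exchange X Y indepX indepY (≰⇒> ∣Y∣≰∣X∣)
  ... | y , y∈Y , y∉X , indepX∪y with augment k indepX∪y indepY ∣Y∣≤′
    where
    ∣Y∣≤′ : ∣ Y ∣ ≤ k + ∣ X ∪ ⁅ y ⁆ ∣
    ∣Y∣≤′ = ≤-trans ∣Y∣≤ (subst (_≤ k + ∣ X ∪ ⁅ y ⁆ ∣) (+-suc k ∣ X ∣)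
              (+-monoʳ-≤ k (p⊂q⇒∣p∣<∣q∣ (p⊆p∪q ⁅ y ⁆ , y , x∈p∪q⁺ (inj₂ (x∈⁅x⁆ y)) , y∉X))))
  ... | Z , indepZ , X∪y⊆Z , Z⊆ , ∣Y∣≤∣Z∣ =
    Z , indepZ , X∪y⊆Z ∘ x∈p∪q⁺ ∘ inj₁ , X∪y∪Y⊆X∪Y ∘ Z⊆ , ∣Y∣≤∣Z∣
    where
    X∪y∪Y⊆X∪Y : (X ∪ ⁅ y ⁆) ∪ Y ⊆ X ∪ Y
    X∪y∪Y⊆X∪Y x∈ with x∈p∪q⁻ _ _ x∈
    ... | inj₂ x∈Y = x∈p∪q⁺ (inj₂ x∈Y)
    ... | inj₁ x∈X∪y with x∈p∪q⁻ _ _ x∈X∪y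
    ... | inj₁ x∈X = x∈p∪q⁺ (inj₁ x∈X)
    ... | inj₂ x∈y = x∈p∪q⁺ (inj₂ (subst (_∈ Y) (sym (x∈⁅y⁆⇒x≡y _ x∈y)) y∈Y))

  extend-to-basis : ∀ {X B} → Indep F X → IsBasis F B → ∃[ Z ] (IsBasis F Z × X ⊆ Z × Z ⊆ X ∪ B)
  extend-to-basis {X} {B} indepX basisB with augment ∣ B ∣ indepX (proj₁ basisB) (m≤m+n ∣ B ∣ ∣ X ∣)
  ... | Z , indepZ , X⊆Z , Z⊆X∪B , ∣B∣≤∣Z∣ = Z , basis-of-size indepZ basisB ∣B∣≤∣Z∣ , X⊆Z , Z⊆X∪B

  swap-basis : ∀ {B b e} → IsBasis F B → b ∈ B → e ∉ B → Indep F ((B - b) ∪ ⁅ e ⁆) →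
               IsBasis F ((B - b) ∪ ⁅ e ⁆)
  swap-basis basisB b∈B e∉B indepSwap =
    basis-of-size indepSwap basisB (≤-reflexive (sym (∣p-x∪⁅y⁆∣≡∣p∣ b∈B e∉B)))

  -- Extend {i} ∪ (B ∩ B') to a basis Z inside B ∪ {i}; Z misses some b ∈ B, and by counting
  -- Z = (B - b) ∪ {i}.
  basis-exchange : ∀ {B B' i} → IsBasis F B → IsBasis F B' → i ∈ B' → i ∉ B →
                   ∃[ b ] (b ∈ B × b ∉ B' × Indep F ((B - b) ∪ ⁅ i ⁆))
  basis-exchange {B} {B'} {i} basisB basisB' i∈B' i∉B
    with extend-to-basis {X = ⁅ i ⁆ ∪ (B ∩ B')} (hereditary _ B' X⊆B' (proj₁ basisB')) basisB
    where
    X⊆B' : ⁅ i ⁆ ∪ (B ∩ B') ⊆ B'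
    X⊆B' x∈ with x∈p∪q⁻ _ _ x∈
    ... | inj₁ x∈i    = subst (_∈ B') (sym (x∈⁅y⁆⇒x≡y _ x∈i)) i∈B'
    ... | inj₂ x∈B∩B' = proj₂ (x∈p∩q⁻ _ _ x∈B∩B')
  ... | Z , basisZ , X⊆Z , Z⊆X∪B with any? (λ b → (b ∈? B) ×-dec ¬? (b ∈? Z))
  ... | no ∄b = ⊥-elim (i∉B (subst (i ∈_) (proj₂ basisB Z (proj₁ basisZ) B⊆Z) i∈Z))
    where
    i∈Z : i ∈ Z
    i∈Z = X⊆Z (x∈p∪q⁺ (inj₁ (x∈⁅x⁆ i)))
    B⊆Z : B ⊆ Z
    B⊆Z {x} x∈B = decidable-stable (x ∈? Z) (λ x∉Z → ∄b (x , x∈B , x∉Z))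
  ... | yes (b , b∈B , b∉Z) = b , b∈B , b∉B' , subst (Indep F) Z≡Swap (proj₁ basisZ)
    where
    b∉B' : b ∉ B'
    b∉B' b∈B' = b∉Z (X⊆Z (x∈p∪q⁺ (inj₂ (x∈p∩q⁺ (b∈B , b∈B')))))
    Z⊆Swap : Z ⊆ (B - b) ∪ ⁅ i ⁆
    Z⊆Swap {x} x∈Z with x ≟ b | x∈p∪q⁻ _ _ (Z⊆X∪B x∈Z)
    ... | yes refl | _ = ⊥-elim (b∉Z x∈Z)
    ... | no x≢b | inj₂ x∈B = x∈p∪q⁺ (inj₁ (x∈p∧x≢y⇒x∈p-y x∈B x≢b))
    ... | no x≢b | inj₁ x∈X with x∈p∪q⁻ _ _ x∈X
    ... | inj₁ x∈i    = x∈p∪q⁺ (inj₂ x∈i)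
    ... | inj₂ x∈B∩B' = x∈p∪q⁺ (inj₁ (x∈p∧x≢y⇒x∈p-y (proj₁ (x∈p∩q⁻ _ _ x∈B∩B')) x≢b))
    Z≡Swap : Z ≡ (B - b) ∪ ⁅ i ⁆
    Z≡Swap = p⊆q⇒∣q∣≤∣p∣⇒p≡q Z⊆Swap (≤-trans (≤-reflexive (∣p-x∪⁅y⁆∣≡∣p∣ b∈B i∉B))
               (indep-size≤basis-size (proj₁ basisB) basisZ))

  Replaceable : Subset n → Fin n → Set
  Replaceable B b = ∃[ e ] (toℕ e < toℕ b × e ∉ B × Indep F ((B - b) ∪ ⁅ e ⁆))

  replaceable? : ∀ B b → Dec (Replaceable B b)
  replaceable? B b = any? λ e → (toℕ e <? toℕ b) ×-dec ¬? (e ∈? B) ×-dec T? (F ((B - b) ∪ ⁅ e ⁆))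

  restrictionSet : Subset n → Subset n
  restrictionSet B = tabulate λ b → ⌊ (b ∈? B) ×-dec replaceable? B b ⌋

  ∈restrictionSet⁻ : ∀ {B b} → b ∈ restrictionSet B → b ∈ B × Replaceable B b
  ∈restrictionSet⁻ {B} = ∈tabulate-⌊⌋⁻ (λ b → (b ∈? B) ×-dec replaceable? B b)

  ∈restrictionSet⁺ : ∀ {B b} → b ∈ B → Replaceable B b → b ∈ restrictionSet B
  ∈restrictionSet⁺ {B} b∈B r = ∈tabulate-⌊⌋⁺ (λ b → (b ∈? B) ×-dec replaceable? B b) (b∈B , r)

  earlier-if-restrictionSet⊈ : ∀ {B A b} → IsBasis F B → A ⊆ B →
                               b ∈ restrictionSet B → b ∉ A → InEarlier F B A
  earlier-if-restrictionSet⊈ {B} {A} {b} basisB A⊆B b∈R b∉A with ∈restrictionSet⁻ b∈R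
  ... | b∈B , e , e<b , e∉B , indepSwap =
    (B - b) ∪ ⁅ e ⁆ , swap-basis basisB b∈B e∉B indepSwap , swap-<lex e<b b∈B e∉B , A⊆Swap
    where
    A⊆Swap : A ⊆ (B - b) ∪ ⁅ e ⁆
    A⊆Swap x∈A = x∈p∪q⁺ (inj₁ (x∈p∧x≢y⇒x∈p-y (A⊆B x∈A) λ { refl → b∉A x∈A }))

  restrictionSet⊈-if-earlier : ∀ {B A} → IsBasis F B → InEarlier F B A →
                               ∃[ b ] (b ∈ restrictionSet B × b ∉ A)
  restrictionSet⊈-if-earlier {B} basisB (B' , basisB' , (i , i∈B' , i∉B , agree) , A⊆B')
    with basis-exchange basisB basisB' i∈B' i∉B
  ... | b , b∈B , b∉B' , indepSwap =
    b , ∈restrictionSet⁺ b∈B (i , i<b , i∉B , indepSwap) , b∉B' ∘ A⊆B'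
    where
    i<b : toℕ i < toℕ b
    i<b with <-cmp (toℕ i) (toℕ b)
    ... | tri< i<b _ _ = i<b
    ... | tri≈ _ i≡b _ = ⊥-elim (i∉B (subst (_∈ B) (sym (toℕ-injective i≡b)) b∈B))
    ... | tri> _ _ b<i = ⊥-elim (b∉B' (proj₂ (agree b b<i) b∈B))

  restrictionSet-isRestriction : ∀ {B} → IsBasis F B → IsRestriction F B (restrictionSet B)
  restrictionSet-isRestriction basisB = basisB , proj₁ ∘ ∈restrictionSet⁻ , λ A A⊆B →
    (λ ¬earlier {x} x∈R → decidable-stable (x ∈? A)
       (¬earlier ∘ earlier-if-restrictionSet⊈ basisB A⊆B x∈R)) ,
    (λ R⊆A earlier → let (b , b∈R , b∉A) = restrictionSet⊈-if-earlier basisB earlier in b∉A (R⊆A b∈R))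

∈firstD⁻ : ∀ {n d} {x : Fin n} → x ∈ firstD d → toℕ x < d
∈firstD⁻ {d = d} = ∈tabulate-⌊⌋⁻ (λ x → toℕ x <? d)

∈firstD⁺ : ∀ {n d} {x : Fin n} → toℕ x < d → x ∈ firstD d
∈firstD⁺ {d = d} = ∈tabulate-⌊⌋⁺ (λ x → toℕ x <? d)

module Lifting {d n : ℕ} (p : d ≤ n) where

  ι : Fin d → Fin n
  ι k = inject≤ k p

  ι-injective : ∀ {k k'} → ι k ≡ ι k' → k ≡ k'
  ι-injective = inject≤-injective p p _ _

  ι-< : ∀ k → toℕ (ι k) < d
  ι-< k = subst (_< d) (sym (toℕ-inject≤ k p)) (toℕ<n k)

  ι-fromℕ< : ∀ {x} (x<d : toℕ x < d) → ι (fromℕ< x<d) ≡ x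
  ι-fromℕ< x<d = toℕ-injective (trans (toℕ-inject≤ _ p) (toℕ-fromℕ< x<d))

  -- The ascription lets lookup∘tabulate refer to the anonymous helper of liftSub, whose case split
  -- on toℕ x <? d the with then exposes.
  lookup-liftSub : ∀ G {x} (x<d : toℕ x < d) → lookup (liftSub p G) x ≡ lookup G (fromℕ< x<d)
  lookup-liftSub G {x} x<d with toℕ x <? d | (lookup (liftSub p G) x ≡ _) ∋ lookup∘tabulate _ x
  ... | yes _   | eq = eq
  ... | no x≮d | _  = ⊥-elim (x≮d x<d)

  lookup-liftSub-≥ : ∀ G {x} → ¬ toℕ x < d → lookup (liftSub p G) x ≡ false
  lookup-liftSub-≥ G {x} x≮d with toℕ x <? d | (lookup (liftSub p G) x ≡ _) ∋ lookup∘tabulate _ x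
  ... | yes x<d | _  = ⊥-elim (x≮d x<d)
  ... | no _    | eq = eq

  ∈liftSub⁻ : ∀ {G x} → x ∈ liftSub p G → ∃[ k ] (ι k ≡ x × k ∈ G)
  ∈liftSub⁻ {G} {x} x∈ with toℕ x <? d
  ... | yes x<d = fromℕ< x<d , ι-fromℕ< x<d ,
                  lookup⇒[]= _ G (trans (sym (lookup-liftSub G x<d)) ([]=⇒lookup x∈))
  ... | no x≮d with trans (sym ([]=⇒lookup x∈)) (lookup-liftSub-≥ G x≮d)
  ... | ()

  ∈liftSub⁺ : ∀ {G k} → k ∈ G → ι k ∈ liftSub p G
  ∈liftSub⁺ {G} {k} k∈G = lookup⇒[]= (ι k) (liftSub p G) (trans (lookup-liftSub G (ι-< k))
    (subst (λ k' → lookup G k' ≡ true) (sym (ι-injective (ι-fromℕ< (ι-< k)))) ([]=⇒lookup k∈G)))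

  ι∈liftSub⁻ : ∀ {G k} → ι k ∈ liftSub p G → k ∈ G
  ι∈liftSub⁻ {G} ιk∈ with ∈liftSub⁻ ιk∈
  ... | k' , ιk'≡ιk , k'∈G = subst (_∈ G) (ι-injective ιk'≡ιk) k'∈G

  ∈liftSub⇒< : ∀ {G x} → x ∈ liftSub p G → toℕ x < d
  ∈liftSub⇒< x∈ with ∈liftSub⁻ x∈
  ... | k , refl , _ = ι-< k

  liftSub-mono : ∀ {A G} → A ⊆ G → liftSub p A ⊆ liftSub p G
  liftSub-mono A⊆G x∈ with ∈liftSub⁻ x∈
  ... | k , refl , k∈A = ∈liftSub⁺ (A⊆G k∈A)

  unlift : Subset n → Subset d
  unlift B = tabulate λ k → lookup B (ι k)

  ∈unlift⁺ : ∀ {B k} → ι k ∈ B → k ∈ unlift B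
  ∈unlift⁺ ιk∈B = ∈tabulate⁺ _ ([]=⇒lookup ιk∈B)

  ∈unlift⁻ : ∀ {B k} → k ∈ unlift B → ι k ∈ B
  ∈unlift⁻ {B} k∈ = lookup⇒[]= _ B (∈tabulate⁻ _ k∈)

  <d⇒∈ι : ∀ {x} → toℕ x < d → ∃[ k ] (ι k ≡ x)
  <d⇒∈ι x<d = fromℕ< x<d , ι-fromℕ< x<d

  ι-<-ι⁺ : ∀ {k k'} → toℕ k < toℕ k' → toℕ (ι k) < toℕ (ι k')
  ι-<-ι⁺ {k} {k'} = subst₂ _<_ (sym (toℕ-inject≤ k p)) (sym (toℕ-inject≤ k' p))

  ι-<-ι⁻ : ∀ {k k'} → toℕ (ι k) < toℕ (ι k') → toℕ k < toℕ k'
  ι-<-ι⁻ {k} {k'} = subst₂ _<_ (toℕ-inject≤ k p) (toℕ-inject≤ k' p)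

module Correspondence {n d : ℕ} (p : d ≤ n) {Δ : Family n} (M : IsMatroid Δ)
                      (basis-[d] : IsBasis Δ (firstD d))
                      {I : Subset n} (I∩[d]≡⊥ : (I ∩ firstD d) ≡ ⊥) where
  open Lifting p
  open MatroidProperties M
  open IsMatroid M

  Γ : Family d
  Γ = Gamma p Δ I

  lift∪I : Subset d → Subset n
  lift∪I G = liftSub p G ∪ I

  <d⇒∉I : ∀ {x} → toℕ x < d → x ∉ I
  <d⇒∉I x<d x∈I = ∉⊥ (subst (_ ∈_) I∩[d]≡⊥ (x∈p∩q⁺ (x∈I , ∈firstD⁺ x<d)))

  I⊆lift∪I : ∀ {G} → I ⊆ lift∪I G
  I⊆lift∪I = x∈p∪q⁺ ∘ inj₂

  ι∈lift∪I⁺ : ∀ {G k} → k ∈ G → ι k ∈ lift∪I G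
  ι∈lift∪I⁺ = x∈p∪q⁺ ∘ inj₁ ∘ ∈liftSub⁺

  ι∈lift∪I⁻ : ∀ {G k} → ι k ∈ lift∪I G → k ∈ G
  ι∈lift∪I⁻ {k = k} ιk∈ with x∈p∪q⁻ _ _ ιk∈
  ... | inj₁ ιk∈G = ι∈liftSub⁻ ιk∈G
  ... | inj₂ ιk∈I = ⊥-elim (<d⇒∉I (ι-< k) ιk∈I)

  lift∪I-mono : ∀ {A G} → A ⊆ G → lift∪I A ⊆ lift∪I G
  lift∪I-mono A⊆G x∈ with x∈p∪q⁻ _ _ x∈
  ... | inj₁ x∈A = x∈p∪q⁺ (inj₁ (liftSub-mono A⊆G x∈A))
  ... | inj₂ x∈I = I⊆lift∪I x∈I

  lift∪I─[d]≡I : ∀ G → lift∪I G ─ firstD d ≡ I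
  lift∪I─[d]≡I G = ⊆-antisym ⊆I I⊆
    where
    ⊆I : lift∪I G ─ firstD d ⊆ I
    ⊆I x∈ with x∈p─q⁻ _ _ x∈
    ... | x∈G∪I , x∉[d] with x∈p∪q⁻ _ _ x∈G∪I
    ... | inj₁ x∈G = ⊥-elim (x∉[d] (∈firstD⁺ (∈liftSub⇒< x∈G)))
    ... | inj₂ x∈I = x∈I
    I⊆ : I ⊆ lift∪I G ─ firstD d
    I⊆ x∈I = x∈p∧x∉q⇒x∈p─q (I⊆lift∪I x∈I) (λ x∈[d] → <d⇒∉I (∈firstD⁻ x∈[d]) x∈I)

  lift∪I-unlift : ∀ {B} → B ─ firstD d ≡ I → lift∪I (unlift B) ≡ B
  lift∪I-unlift {B} B─[d]≡I = ⊆-antisym ⊆B B⊆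
    where
    ⊆B : lift∪I (unlift B) ⊆ B
    ⊆B x∈ with x∈p∪q⁻ _ _ x∈
    ... | inj₂ x∈I = p─q⊆p B (firstD d) (subst (_ ∈_) (sym B─[d]≡I) x∈I)
    ... | inj₁ x∈B with ∈liftSub⁻ x∈B
    ... | k , refl , k∈B = ∈unlift⁻ k∈B
    B⊆ : B ⊆ lift∪I (unlift B)
    B⊆ {x} x∈B with toℕ x <? d
    ... | no x≮d = I⊆lift∪I (subst (_ ∈_) B─[d]≡I (x∈p∧x∉q⇒x∈p─q x∈B (x≮d ∘ ∈firstD⁻)))
    ... | yes x<d with <d⇒∈ι x<d
    ... | k , refl = ι∈lift∪I⁺ (∈unlift⁺ x∈B)

  basis-Δ⇒Γ : ∀ {G} → IsBasis Δ (lift∪I G) → IsBasis Γ G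
  basis-Δ⇒Γ (indepG , maximalG) = indepG , λ G' indepG' G⊆G' → ⊆-antisym
    (λ k∈G' → ι∈lift∪I⁻ (subst (_ ∈_) (maximalG _ indepG' (lift∪I-mono G⊆G')) (ι∈lift∪I⁺ k∈G')))
    G⊆G'

  -- Extend G ∪ I to a basis Z by elements of [d]; each such element k of Z lies in G,
  -- since G ∪ {k} is still independent in Γ_I.
  basis-Γ⇒Δ : ∀ {G} → IsBasis Γ G → IsBasis Δ (lift∪I G)
  basis-Γ⇒Δ {G} (indepG , maximalG) with extend-to-basis indepG basis-[d]
  ... | Z , basisZ , G⊆Z , Z⊆ = subst (IsBasis Δ) (sym (⊆-antisym G⊆Z Z⊆G)) basisZ
    where
    Z⊆G : Z ⊆ lift∪I G
    Z⊆G {x} x∈Z with x∈p∪q⁻ _ _ (Z⊆ x∈Z)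
    ... | inj₁ x∈G = x∈G
    ... | inj₂ x∈[d] with <d⇒∈ι (∈firstD⁻ x∈[d])
    ... | k , refl = ι∈lift∪I⁺ (subst (k ∈_) G∪k≡G (x∈p∪q⁺ (inj₂ (x∈⁅x⁆ k))))
      where
      G∪k⊆Z : lift∪I (G ∪ ⁅ k ⁆) ⊆ Z
      G∪k⊆Z y∈ with x∈p∪q⁻ _ _ y∈
      ... | inj₂ y∈I = G⊆Z (I⊆lift∪I y∈I)
      ... | inj₁ y∈G∪k with ∈liftSub⁻ y∈G∪k
      ... | k' , refl , k'∈G∪k with x∈p∪q⁻ _ _ k'∈G∪k
      ... | inj₁ k'∈G = G⊆Z (ι∈lift∪I⁺ k'∈G)
      ... | inj₂ k'∈k = subst (λ k'' → ι k'' ∈ Z) (sym (x∈⁅y⁆⇒x≡y k k'∈k)) x∈Z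
      G∪k≡G : G ∪ ⁅ k ⁆ ≡ G
      G∪k≡G = maximalG _ (hereditary _ Z G∪k⊆Z (proj₁ basisZ)) (p⊆p∪q ⁅ k ⁆)

  <lex-lift∪I⁺ : ∀ {G' G} → G' <lex G → lift∪I G' <lex lift∪I G
  <lex-lift∪I⁺ {G'} {G} (i , i∈G' , i∉G , agree) = ι i , ι∈lift∪I⁺ i∈G' , i∉G ∘ ι∈lift∪I⁻ , agree′
    where
    agree′ : ∀ x → toℕ x < toℕ (ι i) →
             (x ∈ lift∪I G' → x ∈ lift∪I G) × (x ∈ lift∪I G → x ∈ lift∪I G')
    agree′ x x<ιi with <d⇒∈ι (<-trans x<ιi (ι-< i))
    ... | k , refl = ι∈lift∪I⁺ ∘ proj₁ (agree k (ι-<-ι⁻ x<ιi)) ∘ ι∈lift∪I⁻ ,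
                     ι∈lift∪I⁺ ∘ proj₂ (agree k (ι-<-ι⁻ x<ιi)) ∘ ι∈lift∪I⁻

  <lex-lift∪I⁻ : ∀ {G' G} → lift∪I G' <lex lift∪I G → G' <lex G
  <lex-lift∪I⁻ (x , x∈G' , x∉G , agree) with x∈p∪q⁻ _ _ x∈G'
  ... | inj₂ x∈I = ⊥-elim (x∉G (I⊆lift∪I x∈I))
  ... | inj₁ x∈liftG' with ∈liftSub⁻ x∈liftG'
  ... | i , refl , i∈G' = i , i∈G' , x∉G ∘ ι∈lift∪I⁺ , λ k k<i →
    ι∈lift∪I⁻ ∘ proj₁ (agree (ι k) (ι-<-ι⁺ k<i)) ∘ ι∈lift∪I⁺ ,
    ι∈lift∪I⁻ ∘ proj₂ (agree (ι k) (ι-<-ι⁺ k<i)) ∘ ι∈lift∪I⁺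

  earlier-lift∪I⁺ : ∀ {G A} → InEarlier Γ G A → InEarlier Δ (lift∪I G) (lift∪I A)
  earlier-lift∪I⁺ (G' , basisG' , G'<G , A⊆G') =
    lift∪I G' , basis-Γ⇒Δ basisG' , <lex-lift∪I⁺ G'<G , lift∪I-mono A⊆G'

  -- Otherwise B' ⊇ G ∪ I, contradicting the maximality of the basis G ∪ I.
  first-difference-<d : ∀ {G B' i} → IsBasis Γ G → Indep Δ B' → I ⊆ B' → i ∈ B' → i ∉ lift∪I G →
                        (∀ j → toℕ j < toℕ i → j ∈ lift∪I G → j ∈ B') → toℕ i < d
  first-difference-<d {G} {B'} {i} basisG indepB' I⊆B' i∈B' i∉B agree =
    decidable-stable (toℕ i <? d) λ i≮d →
      i∉B (subst (i ∈_) (proj₂ (basis-Γ⇒Δ basisG) B' indepB' (B⊆B' i≮d)) i∈B')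
    where
    B⊆B' : ¬ toℕ i < d → lift∪I G ⊆ B'
    B⊆B' i≮d x∈ with x∈p∪q⁻ _ _ x∈
    ... | inj₁ x∈G = agree _ (<-≤-trans (∈liftSub⇒< x∈G) (≮⇒≥ i≮d)) x∈
    ... | inj₂ x∈I = I⊆B' x∈I

  ─[d]≡I : ∀ {G Y Z} → I ⊆ Z → Z ⊆ ((Y ∩ firstD d) ∪ I) ∪ lift∪I G → Z ─ firstD d ≡ I
  ─[d]≡I {G} {Y} {Z} I⊆Z Z⊆ = ⊆-antisym ⊆I I⊆
    where
    ⊆I : Z ─ firstD d ⊆ I
    ⊆I x∈ with x∈p─q⁻ _ _ x∈
    ... | x∈Z , x∉[d] with x∈p∪q⁻ _ _ (Z⊆ x∈Z)
    ... | inj₂ x∈G∪I = subst (_ ∈_) (lift∪I─[d]≡I G) (x∈p∧x∉q⇒x∈p─q x∈G∪I x∉[d])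
    ... | inj₁ x∈X with x∈p∪q⁻ _ _ x∈X
    ... | inj₁ x∈Y∩[d] = ⊥-elim (x∉[d] (p∩q⊆q Y (firstD d) x∈Y∩[d]))
    ... | inj₂ x∈I     = x∈I
    I⊆ : I ⊆ Z ─ firstD d
    I⊆ x∈I = x∈p∧x∉q⇒x∈p─q (I⊆Z x∈I) (λ x∈[d] → <d⇒∉I (∈firstD⁻ x∈[d]) x∈I)

  -- An earlier basis B' ⊇ A ∪ I of Δ need not be of the form G' ∪ I, but the basis Z obtained by
  -- extending (B' ∩ [d]) ∪ I inside G ∪ I is, and it still precedes G ∪ I since the first
  -- difference i of B' and G ∪ I lies in [d].
  earlier-lift∪I⁻ : ∀ {G A} → IsBasis Γ G → InEarlier Δ (lift∪I G) (lift∪I A) → InEarlier Γ G A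
  earlier-lift∪I⁻ {G} {A} basisG (B' , basisB' , (i , i∈B' , i∉B , agree) , A⊆B')
    with extend-to-basis {X = (B' ∩ firstD d) ∪ I} (hereditary _ B' X⊆B' (proj₁ basisB'))
                         (basis-Γ⇒Δ basisG)
    where
    X⊆B' : (B' ∩ firstD d) ∪ I ⊆ B'
    X⊆B' x∈ with x∈p∪q⁻ _ _ x∈
    ... | inj₁ x∈B'∩[d] = p∩q⊆p B' (firstD d) x∈B'∩[d]
    ... | inj₂ x∈I      = A⊆B' (I⊆lift∪I x∈I)
  ... | Z , basisZ , X⊆Z , Z⊆X∪B =
    unlift Z , basis-Δ⇒Γ (subst (IsBasis Δ) (sym Z≡) basisZ) ,
    <lex-lift∪I⁻ (subst (_<lex lift∪I G) (sym Z≡) Z<B) , A⊆Z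
    where
    i<d : toℕ i < d
    i<d = first-difference-<d basisG (proj₁ basisB') (A⊆B' ∘ I⊆lift∪I) i∈B' i∉B (proj₂ ∘₂ agree)
    Z≡ : lift∪I (unlift Z) ≡ Z
    Z≡ = lift∪I-unlift (─[d]≡I (X⊆Z ∘ x∈p∪q⁺ ∘ inj₂) Z⊆X∪B)
    B'∩[d]⊆Z : ∀ {x} → x ∈ B' → toℕ x < d → x ∈ Z
    B'∩[d]⊆Z x∈B' x<d = X⊆Z (x∈p∪q⁺ (inj₁ (x∈p∩q⁺ (x∈B' , ∈firstD⁺ x<d))))
    Z<B : Z <lex lift∪I G
    Z<B = i , B'∩[d]⊆Z i∈B' i<d , i∉B , λ j j<i →
      Z⊆B j<i , λ j∈B → B'∩[d]⊆Z (proj₂ (agree j j<i) j∈B) (<-trans j<i i<d)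
      where
      Z⊆B : ∀ {j} → toℕ j < toℕ i → j ∈ Z → j ∈ lift∪I G
      Z⊆B j<i j∈Z with x∈p∪q⁻ _ _ (Z⊆X∪B j∈Z)
      ... | inj₂ j∈B = j∈B
      ... | inj₁ j∈X with x∈p∪q⁻ _ _ j∈X
      ... | inj₁ j∈B'∩[d] = proj₁ (agree _ j<i) (p∩q⊆p B' (firstD d) j∈B'∩[d])
      ... | inj₂ j∈I      = I⊆lift∪I j∈I
    A⊆Z : A ⊆ unlift Z
    A⊆Z {k} k∈A = ∈unlift⁺ (B'∩[d]⊆Z (A⊆B' (ι∈lift∪I⁺ k∈A)) (ι-< k))

  unlift⊆ : ∀ {R A} → R ⊆ lift∪I A → unlift R ⊆ A
  unlift⊆ R⊆A k∈ = ι∈lift∪I⁻ (R⊆A (∈unlift⁻ k∈))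

  ⊆lift∪I : ∀ {R G A} → R ⊆ lift∪I G → unlift R ⊆ A → R ⊆ lift∪I A
  ⊆lift∪I R⊆G R⊆A x∈R with x∈p∪q⁻ _ _ (R⊆G x∈R)
  ... | inj₂ x∈I = I⊆lift∪I x∈I
  ... | inj₁ x∈G with ∈liftSub⁻ x∈G
  ... | k , refl , _ = ι∈lift∪I⁺ (R⊆A (∈unlift⁺ x∈R))

  liftSub-unlift : ∀ {R G} → R ⊆ lift∪I G → liftSub p (unlift R) ≡ R ─ I
  liftSub-unlift {R} R⊆G = ⊆-antisym ⊆R─I R─I⊆
    where
    ⊆R─I : liftSub p (unlift R) ⊆ R ─ I
    ⊆R─I x∈ with ∈liftSub⁻ x∈
    ... | k , refl , k∈R = x∈p∧x∉q⇒x∈p─q (∈unlift⁻ k∈R) (<d⇒∉I (ι-< k))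
    R─I⊆ : R ─ I ⊆ liftSub p (unlift R)
    R─I⊆ x∈ with x∈p─q⁻ _ _ x∈
    ... | x∈R , x∉I with x∈p∪q⁻ _ _ (R⊆G x∈R)
    ... | inj₂ x∈I = ⊥-elim (x∉I x∈I)
    ... | inj₁ x∈G with ∈liftSub⁻ x∈G
    ... | k , refl , _ = ∈liftSub⁺ (∈unlift⁺ x∈R)

  restriction-unlift : ∀ {G R} → IsBasis Γ G → IsRestriction Δ (lift∪I G) R →
                       IsRestriction Γ G (unlift R)
  restriction-unlift basisG (_ , R⊆G , charR) = basisG , unlift⊆ R⊆G , λ A A⊆G →
    let (¬earlier⇒R⊆A , R⊆A⇒¬earlier) = charR (lift∪I A) (lift∪I-mono A⊆G) in
    (λ ¬earlier → unlift⊆ (¬earlier⇒R⊆A (¬earlier ∘ earlier-lift∪I⁻ basisG))) ,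
    (λ unliftR⊆A → R⊆A⇒¬earlier (⊆lift∪I R⊆G unliftR⊆A) ∘ earlier-lift∪I⁺)

  U⊆V : ∀ {X} → InU d Δ I X → ∃[ S ] (InV p Δ I S × liftSub p S ≡ X)
  U⊆V (B , R , _ , B─[d]≡I , restrR , refl) =
    unlift R , (unlift B , basisG , restriction-unlift basisG restrR′) ,
    liftSub-unlift (proj₁ (proj₂ restrR′))
    where
    restrR′ : IsRestriction Δ (lift∪I (unlift B)) R
    restrR′ = subst (λ B → IsRestriction Δ B R) (sym (lift∪I-unlift B─[d]≡I)) restrR
    basisG : IsBasis Γ (unlift B)
    basisG = basis-Δ⇒Γ (proj₁ restrR′)

  V⊆U : ∀ {X} → ∃[ S ] (InV p Δ I S × liftSub p S ≡ X) → InU d Δ I X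
  V⊆U (S , (G , basisG , restrS) , refl) =
    lift∪I G , restrictionSet B , basisB , lift∪I─[d]≡I G , restrR ,
    trans (cong (liftSub p) S≡) (liftSub-unlift (proj₁ (proj₂ restrR)))
    where
    B : Subset n
    B = lift∪I G
    basisB : IsBasis Δ B
    basisB = basis-Γ⇒Δ basisG
    restrR : IsRestriction Δ B (restrictionSet B)
    restrR = restrictionSet-isRestriction basisB
    S≡ : S ≡ unlift (restrictionSet B)
    S≡ = restriction-unique restrS (restriction-unlift basisG restrR)

mainTheorem3 : (n d : ℕ) (p : d ≤ n) (Δ : Family n) → IsMatroid Δ →
               IsBasis Δ (firstD d) →
               (I : Subset n) → Indep Δ I → (I ∩ firstD d) ≡ ⊥ →
               (X : Subset n) →
               (InU d Δ I X → ∃[ S ] (InV p Δ I S × liftSub p S ≡ X)) ×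
               (∃[ S ] (InV p Δ I S × liftSub p S ≡ X) → InU d Δ I X)
mainTheorem3 n d p Δ M basis-[d] I _ I∩[d]≡⊥ X = U⊆V , V⊆U
  where open Correspondence p M basis-[d] I∩[d]≡⊥
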